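{- Let $r\in D_d$. If a sequence $\pi$ is an $r$-extension of a sequence $p_1,\dots,p_n$, then for every priority $p_{n+1}\in\{1,\dots,d\}$ the sequence $\pi$ is also an $r{\restriction}_{p_{n+1}}$-extension of $p_1,\dots,p_n,p_{n+1}$.
   Context: Fix $d\ge1$; all sequences are finite sequences of priorities from $\{1,\dots,d\}$. $D_d=\{1,\dots,d,2d\}$. For $p\in\{1,\dots,d\}$ and $r\in D_d$: $r{\restriction}_p=p+1$ if $p$ is odd and $p>r$; $r{\restriction}_p=p-1$ if $p$ is even and $p\ge r$; $r{\restriction}_p=r$ otherwise. The order $\preceq$ on positive integers is $\dots\preceq5\preceq3\preceq1\preceq2\preceq4\preceq6\preceq\dots$. The leader of a sequence is its maximum, or $1$ if empty; a sequence fulfils $r$ if $r\preceq$ its leader. A sequence $r_1,\dots,r_k$ is a $\preceq$-contraction of $p_1,\dots,p_m$ if there are indices $0=i_0\le i_1\le\dots\le i_k=m$ such that each (possibly empty) infix $p_{i_{j-1}+1},\dots,p_{i_j}$ fulfils $r_j$. For $r\in D_d$, a sequence $\pi_1$ is an $r$-extension of a sequence $\pi_2$ if for every sequence $\pi_3$ that fulfils $r$, $\pi_1$ is a $\preceq$-contraction of the concatenation $\pi_2\cdot\pi_3$. -}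

module Defs where

open import Data.Nat using (ℕ; zero; suc; _+_; _*_; _≤_; _<_; _⊔_)
open import Data.Nat.Properties using (_≤?_; _<?_)
open import Data.Bool using (Bool; true; false; if_then_else_)
open import Data.List using (List; []; _∷_; _++_; foldr)
open import Data.List.Relation.Unary.All using (All)
open import Data.Product using (Σ; _×_; ∃-syntax)
open import Data.Sum using (_⊎_)
open import Relation.Nullary.Decidable using (⌊_⌋)
open import Relation.Binary.PropositionalEquality using (_≡_)

isOdd : ℕ → Bool
isOdd zero = false
isOdd (suc n) = not' (isOdd n)
  where
  not' : Bool → Bool
  not' true = false
  not' false = true

Prio : ℕ → ℕ → Set
Prio d p = 1 ≤ p × p ≤ d

Seq : ℕ → List ℕ → Set
Seq d ps = All (Prio d) ps

InD : ℕ → ℕ → Set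
InD d r = Prio d r ⊎ r ≡ 2 * d

restrict : ℕ → ℕ → ℕ
restrict r p with isOdd p
... | true  = if ⌊ r <? p ⌋ then suc p else r
... | false = if ⌊ r ≤? p ⌋ then p Data.Nat.∸ 1 else r

-- the order ⋯ ⪯ 5 ⪯ 3 ⪯ 1 ⪯ 2 ⪯ 4 ⪯ 6 ⪯ ⋯ on positive integers
data _⪯_ (a b : ℕ) : Set where
  odd-even : isOdd a ≡ true  → isOdd b ≡ false → a ⪯ b
  odd-odd  : isOdd a ≡ true  → isOdd b ≡ true  → b ≤ a → a ⪯ b
  even-even : isOdd a ≡ false → isOdd b ≡ false → a ≤ b → a ⪯ b

leader : List ℕ → ℕ
leader [] = 1
leader (p ∷ ps) = foldr _⊔_ p ps

Fulfils : ℕ → List ℕ → Set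
Fulfils r ps = r ⪯ leader ps

Contraction : List ℕ → List ℕ → Set
Contraction [] ps = ps ≡ []
Contraction (r ∷ rs) ps =
  Σ (List ℕ) λ xs → Σ (List ℕ) λ ys → ps ≡ xs ++ ys × Fulfils r xs × Contraction rs ys

Extension : ℕ → ℕ → List ℕ → List ℕ → Set
Extension d r π₁ π₂ =
  (π₃ : List ℕ) → Seq d π₃ → Fulfils r π₃ → Contraction π₁ (π₂ ++ π₃)

-- Prepending p to a continuation π₃ turns the leader of π₃ into p ⊔ leader π₃, so it suffices
-- that r ⪯ p ⊔ L whenever r↾p ⪯ L. If L ≥ p, then r↾p is either r itself or an odd/even
-- neighbour of p that can only lie ⪯-below L when r does; if L ≤ p, then the hypothesis
-- forces r ⪯ p.
module Submission where

open import Defs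
open import Data.Nat using (ℕ; zero; suc; _≤_; _⊔_)
open import Data.Nat.Properties
  using (≤-trans; ≤-antisym; ≤-total; <⇒≤; ≮⇒≥; 1+n≰n; _<?_; _≤?_;
         m≤n⇒m⊔n≡n; m≥n⇒m⊔n≡m; ⊔-identityʳ; ⊔-assoc; ⊔-comm)
open import Data.Bool using (Bool; true; false)
open import Data.List using (List; _∷_; []; _++_; foldr)
open import Data.List.Properties using (++-assoc)
open import Data.List.Relation.Unary.All using (_∷_)
open import Data.Product using (_×_; _,_; proj₁; proj₂)
open import Data.Sum using (inj₁; inj₂)
open import Relation.Nullary using (yes; no; contradiction)
open import Relation.Binary.PropositionalEquality
  using (_≡_; refl; sym; trans; cong; subst; module ≡-Reasoning)

true≢false : ∀ {b : Bool} → b ≡ true → b ≡ false → ∀ {A : Set} → A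
true≢false refl ()

isOdd-suc-odd : ∀ q → isOdd q ≡ true → isOdd (suc q) ≡ false
isOdd-suc-odd q e rewrite e = refl

≤⇒⪯-even : ∀ {a b} → isOdd b ≡ false → a ≤ b → a ⪯ b
≤⇒⪯-even {a} eb a≤b with isOdd a in ea
... | true  = odd-even ea eb
... | false = even-even ea eb a≤b

even-⪯-inv : ∀ {a b} → isOdd a ≡ false → a ⪯ b → isOdd b ≡ false × a ≤ b
even-⪯-inv ea (odd-even oa _)     = true≢false oa ea
even-⪯-inv ea (odd-odd oa _ _)    = true≢false oa ea
even-⪯-inv ea (even-even _ eb le) = eb , le

⪯-odd-inv : ∀ {a b} → isOdd b ≡ true → a ⪯ b → isOdd a ≡ true × b ≤ a
⪯-odd-inv ob (odd-even _ eb)     = true≢false ob eb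
⪯-odd-inv ob (odd-odd oa _ le)   = oa , le
⪯-odd-inv ob (even-even _ eb _)  = true≢false ob eb

restrict-⪯⇒⪯-≤ : ∀ {r p L} → p ≤ L → restrict r p ⪯ L → r ⪯ L
restrict-⪯⇒⪯-≤ {r} {p} {L} p≤L h with isOdd p in ep
... | true with r <? p
...   | no _ = h
...   | yes r<p with even-⪯-inv (isOdd-suc-odd p ep) h
...     | eL , p<L = ≤⇒⪯-even eL (≤-trans (<⇒≤ r<p) (<⇒≤ p<L))
restrict-⪯⇒⪯-≤ {r} {p} {L} p≤L h | false with r ≤? p
...   | no _ = h
...   | yes r≤p with isOdd L in eL
...     | false = ≤⇒⪯-even eL (≤-trans r≤p p≤L)
...     | true with ⪯-odd-inv eL h
restrict-⪯⇒⪯-≤ {p = zero}  _   _ | false | yes _ | true | ()    , _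
restrict-⪯⇒⪯-≤ {p = suc q} p≤L _ | false | yes _ | true | _ , L≤q =
  contradiction (≤-trans p≤L L≤q) 1+n≰n

restrict-⪯⇒⪯-≥ : ∀ {r p L} → L ≤ p → restrict r p ⪯ L → r ⪯ p
restrict-⪯⇒⪯-≥ {r} {p} {L} L≤p h with isOdd p in ep
... | true with r <? p
...   | yes _ = contradiction (≤-trans (proj₂ (even-⪯-inv (isOdd-suc-odd p ep) h)) L≤p) 1+n≰n
...   | no r≮p with isOdd r in er
...     | true  = odd-odd er ep (≮⇒≥ r≮p)
...     | false = true≢false (trans (cong isOdd r≡p) ep) er
  where r≡p = ≤-antisym (≤-trans (proj₂ (even-⪯-inv er h)) L≤p) (≮⇒≥ r≮p)
restrict-⪯⇒⪯-≥ {r} {p} {L} L≤p h | false with r ≤? p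
...   | yes r≤p = ≤⇒⪯-even ep r≤p
...   | no r≰p with isOdd r in er
...     | true  = odd-even er ep
...     | false = contradiction (≤-trans (proj₂ (even-⪯-inv er h)) L≤p) r≰p

restrict-⪯⇒⪯-⊔ : ∀ r p L → restrict r p ⪯ L → r ⪯ (p ⊔ L)
restrict-⪯⇒⪯-⊔ r p L h with ≤-total p L
... | inj₁ p≤L rewrite m≤n⇒m⊔n≡n p≤L = restrict-⪯⇒⪯-≤ p≤L h
... | inj₂ L≤p rewrite m≥n⇒m⊔n≡m L≤p = restrict-⪯⇒⪯-≥ L≤p h

foldr-⊔ : ∀ p xs → foldr _⊔_ p xs ≡ p ⊔ foldr _⊔_ 0 xs
foldr-⊔ p [] = sym (⊔-identityʳ p)
foldr-⊔ p (x ∷ xs) = begin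
  x ⊔ foldr _⊔_ p xs        ≡⟨ cong (x ⊔_) (foldr-⊔ p xs) ⟩
  x ⊔ (p ⊔ m)               ≡⟨ sym (⊔-assoc x p m) ⟩
  (x ⊔ p) ⊔ m               ≡⟨ cong (_⊔ m) (⊔-comm x p) ⟩
  (p ⊔ x) ⊔ m               ≡⟨ ⊔-assoc p x m ⟩
  p ⊔ (x ⊔ m)               ∎
  where
  open ≡-Reasoning
  m = foldr _⊔_ 0 xs

-- The empty sequence has leader 1, so the side condition 1 ≤ p is needed here.
leader-∷ : ∀ {p} xs → 1 ≤ p → leader (p ∷ xs) ≡ p ⊔ leader xs
leader-∷ []       1≤p = sym (m≥n⇒m⊔n≡m 1≤p)
leader-∷ {p} (x ∷ xs) _ rewrite foldr-⊔ p (x ∷ xs) | foldr-⊔ x xs = refl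

fulfils-∷ : ∀ {r p} xs → 1 ≤ p → Fulfils (restrict r p) xs → Fulfils r (p ∷ xs)
fulfils-∷ {r} {p} xs 1≤p h =
  subst (r ⪯_) (sym (leader-∷ xs 1≤p)) (restrict-⪯⇒⪯-⊔ r p (leader xs) h)

lemma5p6 : (d : ℕ) → 1 ≤ d → (r : ℕ) → InD d r →
    (π ps : List ℕ) → Seq d π → Seq d ps →
    Extension d r π ps →
    (p : ℕ) → Prio d p →
    Extension d (restrict r p) π (ps ++ p ∷ [])
lemma5p6 d _ r _ π ps _ _ ext p p∈d π₃ π₃∈d fulfils
  rewrite ++-assoc ps (p ∷ []) π₃ =
  ext (p ∷ π₃) (p∈d ∷ π₃∈d) (fulfils-∷ π₃ (proj₁ p∈d) fulfils)
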